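{- For every $k\geq 1$, the graph $\widetilde\Omega_{2k}$ is twin-free: if $[\mathbf{u}],[\mathbf{v}]$ are vertices of $\widetilde\Omega_{2k}$ with $N([\mathbf{u}])=N([\mathbf{v}])$, then $[\mathbf{u}]=[\mathbf{v}]$.
   Context: The orthogonality graph $\Omega_{2k}$ has vertex set $\mathbb{Z}_2^{2k}$ (bitstrings of length $2k$), with two vertices adjacent if and only if they differ in exactly $k$ positions. $\mathbf{1}$ is the all-ones bitstring and $+$ is bitwise addition mod 2. The quotient graph $\widetilde\Omega_{2k}$ has vertices $[\mathbf{u}]=\{\mathbf{u},\mathbf{u}+\mathbf{1}\}$, with $[\mathbf{u}]$ and $[\mathbf{x}]$ adjacent iff some element of $[\mathbf{u}]$ is adjacent in $\Omega_{2k}$ to some element of $[\mathbf{x}]$. $N(\cdot)$ denotes the neighborhood in $\widetilde\Omega_{2k}$. -}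

module Defs where

open import Data.Nat using (ℕ; zero; suc; _+_; _*_)
open import Data.Bool using (Bool; true; false; not; _xor_)
open import Data.Vec using (Vec; []; _∷_; map; zipWith; replicate)
open import Data.Sum using (_⊎_)
open import Data.Product using (Σ; _×_)
open import Relation.Binary.PropositionalEquality using (_≡_)

BitString : ℕ → Set
BitString n = Vec Bool n

ones : (n : ℕ) → BitString n
ones n = replicate n true

_⊕_ : {n : ℕ} → BitString n → BitString n → BitString n
_⊕_ = zipWith _xor_

hamming : {n : ℕ} → BitString n → BitString n → ℕ
hamming [] [] = 0
hamming (a ∷ u) (b ∷ v) with a xor b
... | true  = suc (hamming u v)
... | false = hamming u v

Adjacent : (k : ℕ) → BitString (2 * k) → BitString (2 * k) → Set
Adjacent k u x = hamming u x ≡ k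

InClass : {n : ℕ} → BitString n → BitString n → Set
InClass {n} u w = (w ≡ u) ⊎ (w ≡ u ⊕ ones n)

SameClass : {n : ℕ} → BitString n → BitString n → Set
SameClass {n} u v = InClass u v

QAdjacent : (k : ℕ) → BitString (2 * k) → BitString (2 * k) → Set
QAdjacent k u x =
  Σ (BitString (2 * k)) λ a → Σ (BitString (2 * k)) λ b →
    InClass u a × InClass x b × Adjacent k a b

SameNeighbourhood : (k : ℕ) → BitString (2 * k) → BitString (2 * k) → Set
SameNeighbourhood k u v =
  (x : BitString (2 * k)) → (QAdjacent k u x → QAdjacent k v x) × (QAdjacent k v x → QAdjacent k u x)

-- For distinct classes [u] ≠ [v] we have 0 < d(u,v) < 2k, and replacing v by v + 𝟏 we may assume
-- d(u,v) ≤ k. Flipping u on the d(u,v) positions where it differs from v and on k − d(u,v)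
-- positions where it agrees with v gives x at distance k from u but k − d(u,v) ≠ k from v.
-- Since d(w + 𝟏, x) = 2k − d(w, x), adjacency of classes is adjacency of any representatives,
-- so [x] lies in N([u]) but not in N([v]).
module Submission where

open import Defs
open import Data.Nat using (ℕ; zero; suc; _+_; _*_; _∸_; _≤_; _<_; _≥_; z≤n; s≤s; z<s)
open import Data.Nat.Properties
  using (+-suc; +-comm; +-identityʳ; +-cancelˡ-≡; +-cancelʳ-≡; +-cancelˡ-≤; +-cancelʳ-≤; +-monoʳ-≤;
         +-monoˡ-≤; ≤-refl; ≤-trans; ≤-total; m∸n≤m; m+[n∸m]≡n; ∸-monoʳ-<; <⇒≢)
open import Data.Bool using (true; false)
open import Data.Vec using ([]; _∷_)
open import Data.Sum using (_⊎_; inj₁; inj₂)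
open import Data.Product using (_×_; _,_; proj₁; ∃-syntax)
open import Data.Empty using (⊥-elim)
open import Function.Bundles using (_⇔_; mk⇔; Equivalence)
open import Relation.Nullary using (¬_)
open import Relation.Binary.PropositionalEquality
  using (_≡_; refl; sym; trans; cong; subst; module ≡-Reasoning)

open Equivalence using (to; from)

complement : {n : ℕ} → BitString n → BitString n
complement {n} u = u ⊕ ones n

complement-involutive : {n : ℕ} (u : BitString n) → complement (complement u) ≡ u
complement-involutive []          = refl
complement-involutive (true ∷ u)  = cong (true ∷_) (complement-involutive u)
complement-involutive (false ∷ u) = cong (false ∷_) (complement-involutive u)

hamming≡0⇒≡ : {n : ℕ} (u w : BitString n) → hamming u w ≡ 0 → u ≡ w
hamming≡0⇒≡ []          []          _ = refl
hamming≡0⇒≡ (true ∷ u)  (true ∷ w)  e = cong (true ∷_) (hamming≡0⇒≡ u w e)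
hamming≡0⇒≡ (false ∷ u) (false ∷ w) e = cong (false ∷_) (hamming≡0⇒≡ u w e)
hamming≡0⇒≡ (true ∷ u)  (false ∷ w) ()
hamming≡0⇒≡ (false ∷ u) (true ∷ w)  ()

hamming-complementʳ : {n : ℕ} (u x : BitString n) → hamming u (complement x) + hamming u x ≡ n
hamming-complementʳ []          []          = refl
hamming-complementʳ (true ∷ u)  (true ∷ x)  = cong suc (hamming-complementʳ u x)
hamming-complementʳ (false ∷ u) (false ∷ x) = cong suc (hamming-complementʳ u x)
hamming-complementʳ (true ∷ u)  (false ∷ x) = trans (+-suc _ _) (cong suc (hamming-complementʳ u x))
hamming-complementʳ (false ∷ u) (true ∷ x)  = trans (+-suc _ _) (cong suc (hamming-complementʳ u x))

hamming-complement-swap : {n : ℕ} (u x : BitString n) →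
  hamming (complement u) x ≡ hamming u (complement x)
hamming-complement-swap []          []          = refl
hamming-complement-swap (true ∷ u)  (true ∷ x)  = cong suc (hamming-complement-swap u x)
hamming-complement-swap (false ∷ u) (false ∷ x) = cong suc (hamming-complement-swap u x)
hamming-complement-swap (true ∷ u)  (false ∷ x) = hamming-complement-swap u x
hamming-complement-swap (false ∷ u) (true ∷ x)  = hamming-complement-swap u x

hamming-complement-both : {n : ℕ} (u x : BitString n) →
  hamming (complement u) (complement x) ≡ hamming u x
hamming-complement-both u x = begin
  hamming (complement u) (complement x)  ≡⟨ hamming-complement-swap u (complement x) ⟩
  hamming u (complement (complement x))  ≡⟨ cong (hamming u) (complement-involutive x) ⟩
  hamming u x                            ∎
  where open ≡-Reasoning

m+n≡2o⇒m≡o⇒n≡o : {m n o : ℕ} → m + n ≡ 2 * o → m ≡ o → n ≡ o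
m+n≡2o⇒m≡o⇒n≡o {n = n} {o} s refl = trans (+-cancelˡ-≡ o n (o + 0) s) (+-identityʳ o)

m+n≡2o⇒m≤o⊎n≤o : {m n o : ℕ} → m + n ≡ 2 * o → m ≤ o ⊎ n ≤ o
m+n≡2o⇒m≤o⊎n≤o {m} {n} {o} s with ≤-total m o
... | inj₁ m≤o = inj₁ m≤o
... | inj₂ o≤m = inj₂ (+-cancelˡ-≤ o n o (subst (o + n ≤_) o+o (+-monoˡ-≤ n o≤m)))
  where
  o+o : m + n ≡ o + o
  o+o = trans s (cong (o +_) (+-identityʳ o))

adjacent-complementʳ : {k : ℕ} (u x : BitString (2 * k)) →
  Adjacent k u (complement x) ⇔ Adjacent k u x
adjacent-complementʳ u x = mk⇔
  (m+n≡2o⇒m≡o⇒n≡o (hamming-complementʳ u x))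
  (m+n≡2o⇒m≡o⇒n≡o (trans (+-comm (hamming u x) _) (hamming-complementʳ u x)))

adjacent-complementˡ : {k : ℕ} (u x : BitString (2 * k)) →
  Adjacent k (complement u) x ⇔ Adjacent k u x
adjacent-complementˡ u x = mk⇔
  (λ adj → to (adjacent-complementʳ u x) (trans (sym (hamming-complement-swap u x)) adj))
  (λ adj → trans (hamming-complement-swap u x) (from (adjacent-complementʳ u x) adj))

qadjacent⇒adjacent : {k : ℕ} (u x : BitString (2 * k)) → QAdjacent k u x → Adjacent k u x
qadjacent⇒adjacent u x (_ , _ , inj₁ refl , inj₁ refl , adj) = adj
qadjacent⇒adjacent u x (_ , _ , inj₁ refl , inj₂ refl , adj) = to (adjacent-complementʳ u x) adj
qadjacent⇒adjacent u x (_ , _ , inj₂ refl , inj₁ refl , adj) = to (adjacent-complementˡ u x) adj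
qadjacent⇒adjacent u x (_ , _ , inj₂ refl , inj₂ refl , adj) =
  trans (sym (hamming-complement-both u x)) adj

sameNeighbourhood⇒adjacent : {k : ℕ} {u v x : BitString (2 * k)} →
  SameNeighbourhood k u v → Adjacent k u x → Adjacent k v x
sameNeighbourhood⇒adjacent {v = v} {x} same adj =
  qadjacent⇒adjacent v x (proj₁ (same x) (_ , _ , inj₁ refl , inj₁ refl , adj))

-- x is u flipped on j of the positions where u and v differ and on l of those where they agree.
∃-at-hamming-distances : {n : ℕ} (u v : BitString n) {j l : ℕ} →
  j ≤ hamming u v → l ≤ hamming u (complement v) →
  ∃[ x ] hamming u x ≡ j + l × hamming v x + j ≡ hamming u v + l
∃-at-hamming-distances [] [] z≤n z≤n = [] , refl , refl
∃-at-hamming-distances (true ∷ u) (true ∷ v) p z≤n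
  with x , ux , vx ← ∃-at-hamming-distances u v p z≤n = true ∷ x , ux , vx
∃-at-hamming-distances (true ∷ u) (true ∷ v) {j} {suc l} p (s≤s q)
  with x , ux , vx ← ∃-at-hamming-distances u v p q =
  false ∷ x , trans (cong suc ux) (sym (+-suc j l)) , trans (cong suc vx) (sym (+-suc _ l))
∃-at-hamming-distances (false ∷ u) (false ∷ v) p z≤n
  with x , ux , vx ← ∃-at-hamming-distances u v p z≤n = false ∷ x , ux , vx
∃-at-hamming-distances (false ∷ u) (false ∷ v) {j} {suc l} p (s≤s q)
  with x , ux , vx ← ∃-at-hamming-distances u v p q =
  true ∷ x , trans (cong suc ux) (sym (+-suc j l)) , trans (cong suc vx) (sym (+-suc _ l))
∃-at-hamming-distances (true ∷ u) (false ∷ v) z≤n q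
  with x , ux , vx ← ∃-at-hamming-distances u v z≤n q = true ∷ x , ux , cong suc vx
∃-at-hamming-distances (true ∷ u) (false ∷ v) {suc j} (s≤s p) q
  with x , ux , vx ← ∃-at-hamming-distances u v p q =
  false ∷ x , cong suc ux , trans (+-suc _ j) (cong suc vx)
∃-at-hamming-distances (false ∷ u) (true ∷ v) z≤n q
  with x , ux , vx ← ∃-at-hamming-distances u v z≤n q = false ∷ x , ux , cong suc vx
∃-at-hamming-distances (false ∷ u) (true ∷ v) {suc j} (s≤s p) q
  with x , ux , vx ← ∃-at-hamming-distances u v p q =
  true ∷ x , cong suc ux , trans (+-suc _ j) (cong suc vx)

separating-vertex : {k : ℕ} (u v : BitString (2 * k)) →
  0 < hamming u v → hamming u v ≤ k → ∃[ x ] Adjacent k u x × ¬ Adjacent k v x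
separating-vertex {k} u v d>0 d≤k =
  separate (∃-at-hamming-distances u v {l = k ∸ d} ≤-refl (≤-trans (m∸n≤m k d) k≤a))
  where
  d = hamming u v
  a = hamming u (complement v)

  k≤a : k ≤ a
  k≤a = +-cancelʳ-≤ k k a (subst (_≤ a + k) a+d≡k+k (+-monoʳ-≤ a d≤k))
    where
    a+d≡k+k : a + d ≡ k + k
    a+d≡k+k = trans (hamming-complementʳ u v) (cong (k +_) (+-identityʳ k))

  not-adjacent : {x : BitString (2 * k)} → hamming v x + d ≡ d + (k ∸ d) → ¬ Adjacent k v x
  not-adjacent {x} vx adj = <⇒≢ (∸-monoʳ-< d>0 d≤k) (begin
    k ∸ d        ≡⟨ sym (+-cancelʳ-≡ d (hamming v x) (k ∸ d) (trans vx (+-comm d (k ∸ d)))) ⟩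
    hamming v x  ≡⟨ adj ⟩
    k            ∎)
    where open ≡-Reasoning

  separate : ∃[ x ] hamming u x ≡ d + (k ∸ d) × hamming v x + d ≡ d + (k ∸ d) →
    ∃[ x ] Adjacent k u x × ¬ Adjacent k v x
  separate (x , ux , vx) = x , trans ux (m+[n∸m]≡n d≤k) , not-adjacent vx

distinct-classes-not-twins : {k : ℕ} (u v : BitString (2 * k)) →
  0 < hamming u v → 0 < hamming u (complement v) → ¬ SameNeighbourhood k u v
distinct-classes-not-twins u v d>0 a>0 same
  with m+n≡2o⇒m≤o⊎n≤o (hamming-complementʳ u v)
... | inj₁ a≤k with x , ux , ¬cvx ← separating-vertex u (complement v) a>0 a≤k =
  ¬cvx (from (adjacent-complementˡ v x) (sameNeighbourhood⇒adjacent same ux))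
... | inj₂ d≤k with x , ux , ¬vx ← separating-vertex u v d>0 d≤k =
  ¬vx (sameNeighbourhood⇒adjacent same ux)

lemma5 : (k : ℕ) → k ≥ 1 → (u v : BitString (2 * k)) →
    SameNeighbourhood k u v → SameClass u v
lemma5 k _ u v same with hamming u v in d≡ | hamming u (complement v) in a≡
... | zero  | _     = inj₁ (sym (hamming≡0⇒≡ u v d≡))
... | suc _ | zero  = inj₂ (begin
  v                          ≡⟨ sym (complement-involutive v) ⟩
  complement (complement v)  ≡⟨ cong complement (sym (hamming≡0⇒≡ u (complement v) a≡)) ⟩
  complement u               ∎)
  where open ≡-Reasoning
... | suc _ | suc _ = ⊥-elim (distinct-classes-not-twins u v
  (subst (0 <_) (sym d≡) z<s) (subst (0 <_) (sym a≡) z<s) same)
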